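{- Let $\Gamma = x_1\colon \mathrm{N}_{\mathrm{norm}},\dots,x_m\colon\mathrm{N}_{\mathrm{norm}},\; y_1\colon\mathrm{N}_{\mathrm{safe}},\dots,y_n\colon\mathrm{N}_{\mathrm{safe}}$ and suppose the $\mathsf{BCL}$ judgment $\Gamma\vdash e\colon(\mathbf b_1,\dots,\mathbf b_\ell)\to\mathbf b$ is derivable ($\mathbf b_i,\mathbf b$ base types). Then there is a polynomial $q$ in $|w_1|,\dots,|w_\ell|,|x_1|,\dots,|x_m|,|y_1|,\dots,|y_n|$ such that for all strings $w_1,\dots,w_\ell$ and all values of $x_1,\dots,y_n$, $q$ bounds the CEK-cost of evaluating $(e\,w_1\,\dots\,w_\ell)$ in the environment assigning the given values to $x_1,\dots,y_n$.
   Context: Natural numbers are identified with binary strings in $\{\mathbf 0,\mathbf 1\}^*$ via dyadic notation; $|v|$ is the length of $v$, $\epsilon$ the empty string, $a\oplus v$ concatenation. $\mathsf{BCL}$ raw expressions: $e::= k \mid (\mathsf c_{\mathbf 0}\,e)\mid(\mathsf c_{\mathbf 1}\,e)\mid(\mathsf d\,e)\mid(\mathsf t_{\mathbf 0}\,e)\mid(\mathsf t_{\mathbf 1}\,e)\mid(\mathsf{down}\,e\,e)\mid x\mid(e\,e)\mid(\lambda x.e)\mid(\mathsf{If}\,e\,\mathsf{then}\,e\,\mathsf{else}\,e)\mid(\mathsf{prn}\,e)$, $k$ ranging over strings, all variables of base type. Types: level-0 and level-1 simple types over base types $\mathrm N_{\mathrm{norm}},\mathrm N_{\mathrm{safe}}$,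 subtyping generated by $\mathrm N_{\mathrm{norm}}<:\mathrm N_{\mathrm{safe}}$ and the usual contravariant/covariant arrow rule. Typing rules (contexts are finite maps from variables to types; $\cup$ is union of consistent contexts): variable rule $\Gamma,x\colon\sigma\vdash x\colon\sigma$; $\lambda$-introduction; application ($\Gamma_0\vdash e_0\colon\sigma\to\tau$, $\Gamma_1\vdash e_1\colon\sigma$ give $\Gamma_0\cup\Gamma_1\vdash(e_0e_1)\colon\tau$); $\Gamma\vdash k\colon\mathrm N_{\mathrm{safe}}$; $\Gamma\vdash\epsilon\colon\mathrm N_{\mathrm{norm}}$; $\mathrm{op}\in\{\mathsf c_{\mathbf0},\mathsf c_{\mathbf1},\mathsf d,\mathsf t_{\mathbf0},\mathsf t_{\mathbf1}\}$ maps $\mathrm N_{\mathrm{safe}}$ to $\mathrm N_{\mathrm{safe}}$; $\mathsf d$ also maps $\mathrm N_{\mathrm{norm}}$ to $\mathrm N_{\mathrm{norm}}$; $\mathsf{down}$ and $\mathsf{If}$ take $\mathrm N_{\mathrm{safe}}$ arguments to $\mathrm N_{\mathrm{safe}}$ (contexts unioned); subsumption; from $\Gamma\vdash e\colon\mathrm N_{\mathrm{norm}}\to\mathrm N_{\mathrm{safe}}\to\mathrm N_{\mathrm{safe}}$ infer $\Gamma\vdash(\mathsf{prn}\,e)\colon\mathrm N_{\mathrm{norm}}\to\mathrm N_{\mathrm{safe}}$. Basic operations: $\mathsf c_a v=a\oplus v$; $\mathsf d(a\oplus v)=v$, $\mathsf d\epsilon=\epsilon$; $\mathsf t_a v=\mathbf0$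 if $v$ begins with $a$, else $\epsilon$; $\mathrm{down}(v_0,v_1)=v_0$ if $|v_0|\le|v_1|$, else $\epsilon$. CEK machine: values are strings and $\lambda$-terms; a CEK-environment is a finite map from variables to closures $\langle v,\hat\rho\rangle$ ($v$ a value, $\hat\rho$ an environment); states are triples $\langle C,\hat\rho,\kappa\rangle$ with $C$ a term or value and $\kappa$ a continuation. Transitions ($B$ a basic operation): $\langle(B\,e),\hat\rho,\kappa\rangle\to\langle e,\hat\rho,\langle\mathsf{op},B,\kappa\rangle\rangle$; $\langle v,\hat\rho,\langle\mathsf{op},B,\kappa\rangle\rangle\to\langle B(v),\{\},\kappa\rangle$; $\langle(\mathsf{down}\,e\,e'),\hat\rho,\kappa\rangle\to\langle e,\hat\rho,\langle\mathsf{dn},e',\hat\rho,\kappa\rangle\rangle$; $\langle v,\hat\rho,\langle\mathsf{dn},e',\hat\rho',\kappa\rangle\rangle\to\langle e',\hat\rho',\langle\mathsf{dn}',v,\kappa\rangle\rangle$; $\langle v',\hat\rho',\langle\mathsf{dn}',v,\kappa\rangle\rangle\to\langle\mathrm{down}(v,v'),\{\},\kappa\rangle$; $\langle x,\hat\rho,\kappa\rangle\to\langle v,\hat\rho',\kappa\rangle$ where $\hat\rho(x)=\langle v,\hat\rho'\rangle$; $\langle(e\,e'),\hat\rho,\kappa\rangle\to\langle e,\hat\rho,\langle\mathsf{arg},e',\hat\rho,\kappa\rangle\rangle$; $\langle v,\hat\rho,\langle\mathsf{arg},e',\hat\rho',\kappa\rangle\rangle\to\langle e',\hat\rho',\langle\mathsf{fun},v,\hat\rho,\kappa\rangle\rangle$;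 $\langle v',\hat\rho',\langle\mathsf{fun},\lambda x.e,\hat\rho,\kappa\rangle\rangle\to\langle e,\hat\rho[x\mapsto\langle v',\hat\rho'\rangle],\kappa\rangle$; $\langle\mathsf{If}\,e_?\,\mathsf{then}\,e_t\,\mathsf{else}\,e_f,\hat\rho,\kappa\rangle\to\langle e_?,\hat\rho,\langle\mathsf{test},e_t,e_f,\hat\rho,\kappa\rangle\rangle$; $\langle v_?,\hat\rho',\langle\mathsf{test},e_t,e_f,\hat\rho,\kappa\rangle\rangle\to\langle e_t,\hat\rho,\kappa\rangle$ if $v_?\neq\epsilon$ and $\to\langle e_f,\hat\rho,\kappa\rangle$ if $v_?=\epsilon$; $\langle(\mathsf{prn}\,e),\hat\rho,\kappa\rangle\to\langle\lambda y.(\mathsf{If}\,y\,\mathsf{then}\,(e\,y\,(\mathsf{prn}\,e\,(\mathsf d\,y)))\,\mathsf{else}\,(e\,\epsilon\,\epsilon)),\hat\rho,\kappa\rangle$. Costs: the $\mathsf{dn}'$ step costs $1+|v|+|v'|$; the variable-lookup step costs $\max(1,|v|)$ when the looked-up value $v$ is a string and $1$ otherwise; every other step costs $1$. For an ordinary environment $\rho$ mapping variables to strings, the CEK-cost of evaluating $e$ in $\rho$ is the sum of step costs of the run from $\langle e,\rho^*,\mathsf{halt}\rangle$ to a state $\langle v,\hat\rho',\mathsf{halt}\rangle$ with $v$ a value, where $\rho^*(x)=\langle\rho(x),\{\}\rangle$. -}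

module Defs where

open import Data.Bool using (Bool; true; false; if_then_else_)
open import Data.Nat using (ℕ; zero; suc; _+_; _*_; _≤_; _⊔_; _≤ᵇ_; _≡ᵇ_)
open import Data.Fin using (Fin)
open import Data.List using (List; []; _∷_; length)
open import Data.Vec using (Vec; []; _∷_; toList; lookup)
open import Data.Maybe using (Maybe; just; nothing)
open import Data.Product using (Σ; _×_; _,_)
open import Relation.Binary.PropositionalEquality using (_≡_; _≢_)

-- Strings over {𝟎,𝟏}: 𝟎 = false, 𝟏 = true.  |v| = length v, ε = [].

Str : Set
Str = List Bool

∣_∣ : Str → ℕ
∣ v ∣ = length v

Var : Set
Var = ℕ

data BOp : Set where
  c₀ c₁ dd t₀ t₁ : BOp

hasHead : Bool → Str → Bool
hasHead a []      = false
hasHead true  (true  ∷ _) = true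
hasHead false (false ∷ _) = true
hasHead _ _ = false

applyB : BOp → Str → Str
applyB c₀ v = false ∷ v
applyB c₁ v = true ∷ v
applyB dd []      = []
applyB dd (_ ∷ v) = v
applyB t₀ v = if hasHead false v then false ∷ [] else []
applyB t₁ v = if hasHead true  v then false ∷ [] else []

downF : Str → Str → Str
downF v₀ v₁ = if ∣ v₀ ∣ ≤ᵇ ∣ v₁ ∣ then v₀ else []

data Tm : Set where
  lit  : Str → Tm
  bop  : BOp → Tm → Tm
  down : Tm → Tm → Tm
  var  : Var → Tm
  app  : Tm → Tm → Tm
  lam  : Var → Tm → Tm
  ifte : Tm → Tm → Tm → Tm
  prn  : Tm → Tm

data IsValue : Tm → Set where
  vlit : ∀ {k} → IsValue (lit k)
  vlam : ∀ {x e} → IsValue (lam x e)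

data Base : Set where
  Nnorm Nsafe : Base

data Ty : Set where
  base : Base → Ty
  _⇒_  : Base → Ty → Ty

infixr 5 _⇒_

data _≤B_ : Base → Base → Set where
  ≤B-refl : ∀ {a} → a ≤B a
  norm≤safe : Nnorm ≤B Nsafe

data _<:_ : Ty → Ty → Set where
  <:-base : ∀ {a b} → a ≤B b → base a <: base b
  <:-arr  : ∀ {a a' τ τ'} → a' ≤B a → τ <: τ' → (a ⇒ τ) <: (a' ⇒ τ')

arrows : ∀ {ℓ} → Vec Base ℓ → Base → Ty
arrows []       b = base b
arrows (a ∷ as) b = a ⇒ arrows as b

Ctx : Set
Ctx = Var → Maybe Base

-- Γ , x : σ   (x ∉ dom Γ is required in the rules)
_,,_∶_ : Ctx → Var → Base → Ctx
(Γ ,, x ∶ σ) y = if y ≡ᵇ x then just σ else Γ y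

Consistent : Ctx → Ctx → Set
Consistent Γ₀ Γ₁ = ∀ x a b → Γ₀ x ≡ just a → Γ₁ x ≡ just b → a ≡ b

_∪_ : Ctx → Ctx → Ctx
(Γ₀ ∪ Γ₁) x with Γ₀ x
... | just a  = just a
... | nothing = Γ₁ x

IsUnion : Ctx → Ctx → Ctx → Set
IsUnion Γ₀ Γ₁ Γ = Consistent Γ₀ Γ₁ × (∀ x → Γ x ≡ (Γ₀ ∪ Γ₁) x)

IsUnion3 : Ctx → Ctx → Ctx → Ctx → Set
IsUnion3 Γ₀ Γ₁ Γ₂ Γ =
  Consistent Γ₀ Γ₁ × Consistent (Γ₀ ∪ Γ₁) Γ₂ × (∀ x → Γ x ≡ ((Γ₀ ∪ Γ₁) ∪ Γ₂) x)

data _⊢_∶_ : Ctx → Tm → Ty → Set where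
  ⊢var  : ∀ {Γ x σ} → Γ x ≡ just σ → Γ ⊢ var x ∶ base σ
  ⊢lam  : ∀ {Γ x σ e τ} → Γ x ≡ nothing → (Γ ,, x ∶ σ) ⊢ e ∶ τ
        → Γ ⊢ lam x e ∶ (σ ⇒ τ)
  ⊢app  : ∀ {Γ Γ₀ Γ₁ e₀ e₁ σ τ} → Γ₀ ⊢ e₀ ∶ (σ ⇒ τ) → Γ₁ ⊢ e₁ ∶ base σ
        → IsUnion Γ₀ Γ₁ Γ → Γ ⊢ app e₀ e₁ ∶ τ
  ⊢lit  : ∀ {Γ k} → Γ ⊢ lit k ∶ base Nsafe
  ⊢ε    : ∀ {Γ} → Γ ⊢ lit [] ∶ base Nnorm
  ⊢op   : ∀ {Γ B e} → Γ ⊢ e ∶ base Nsafe → Γ ⊢ bop B e ∶ base Nsafe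
  ⊢d    : ∀ {Γ e} → Γ ⊢ e ∶ base Nnorm → Γ ⊢ bop dd e ∶ base Nnorm
  ⊢down : ∀ {Γ Γ₀ Γ₁ e₀ e₁} → Γ₀ ⊢ e₀ ∶ base Nsafe → Γ₁ ⊢ e₁ ∶ base Nsafe
        → IsUnion Γ₀ Γ₁ Γ → Γ ⊢ down e₀ e₁ ∶ base Nsafe
  ⊢if   : ∀ {Γ Γ₀ Γ₁ Γ₂ e₀ e₁ e₂} → Γ₀ ⊢ e₀ ∶ base Nsafe → Γ₁ ⊢ e₁ ∶ base Nsafe
        → Γ₂ ⊢ e₂ ∶ base Nsafe → IsUnion3 Γ₀ Γ₁ Γ₂ Γ
        → Γ ⊢ ifte e₀ e₁ e₂ ∶ base Nsafe
  ⊢sub  : ∀ {Γ e σ τ} → Γ ⊢ e ∶ σ → σ <: τ → Γ ⊢ e ∶ τ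
  ⊢prn  : ∀ {Γ e} → Γ ⊢ e ∶ (Nnorm ⇒ Nsafe ⇒ base Nsafe)
        → Γ ⊢ prn e ∶ (Nnorm ⇒ base Nsafe)

data Clo : Set where
  clo : Tm → List (Var × Clo) → Clo

CEnv : Set
CEnv = List (Var × Clo)

lookupEnv : CEnv → Var → Maybe Clo
lookupEnv []             y = nothing
lookupEnv ((x , c) ∷ ρ) y = if y ≡ᵇ x then just c else lookupEnv ρ y

_[_↦_] : CEnv → Var → Clo → CEnv
ρ [ x ↦ c ] = (x , c) ∷ ρ

data Kont : Set where
  halt  : Kont
  opK   : BOp → Kont → Kont
  dnK   : Tm → CEnv → Kont → Kont
  dn'K  : Tm → Kont → Kont
  argK  : Tm → CEnv → Kont → Kont
  funK  : Tm → CEnv → Kont → Kont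
  testK : Tm → Tm → CEnv → Kont → Kont

record State : Set where
  constructor ⟨_,_,_⟩
  field
    ctrl : Tm
    env  : CEnv
    kont : Kont

-- largest variable name occurring in a term (used to pick a fresh y)
maxVar : Tm → ℕ
maxVar (lit _)        = 0
maxVar (bop _ e)      = maxVar e
maxVar (down e e')    = maxVar e ⊔ maxVar e'
maxVar (var x)        = x
maxVar (app e e')     = maxVar e ⊔ maxVar e'
maxVar (lam x e)      = x ⊔ maxVar e
maxVar (ifte e e' e'') = maxVar e ⊔ maxVar e' ⊔ maxVar e''
maxVar (prn e)        = maxVar e

prnUnfold : Tm → Tm
prnUnfold e =
  lam y (ifte (var y)
              (app (app e (var y)) (app (prn e) (bop dd (var y))))
              (app (app e (lit [])) (lit [])))
  where y = suc (maxVar e)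

lookupCost : Tm → ℕ
lookupCost (lit s) = 1 ⊔ ∣ s ∣
lookupCost _       = 1

data _⟶[_]_ : State → ℕ → State → Set where
  s-op   : ∀ {B e ρ κ} → ⟨ bop B e , ρ , κ ⟩ ⟶[ 1 ] ⟨ e , ρ , opK B κ ⟩
  s-op'  : ∀ {v B ρ κ} → ⟨ lit v , ρ , opK B κ ⟩ ⟶[ 1 ] ⟨ lit (applyB B v) , [] , κ ⟩
  s-dn   : ∀ {e e' ρ κ} → ⟨ down e e' , ρ , κ ⟩ ⟶[ 1 ] ⟨ e , ρ , dnK e' ρ κ ⟩
  s-dn1  : ∀ {v e' ρ ρ' κ} → IsValue v
         → ⟨ v , ρ , dnK e' ρ' κ ⟩ ⟶[ 1 ] ⟨ e' , ρ' , dn'K v κ ⟩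
  s-dn2  : ∀ {v v' ρ' κ}
         → ⟨ lit v' , ρ' , dn'K (lit v) κ ⟩ ⟶[ 1 + ∣ v ∣ + ∣ v' ∣ ] ⟨ lit (downF v v') , [] , κ ⟩
  s-var  : ∀ {x ρ κ v ρ'} → lookupEnv ρ x ≡ just (clo v ρ')
         → ⟨ var x , ρ , κ ⟩ ⟶[ lookupCost v ] ⟨ v , ρ' , κ ⟩
  s-app  : ∀ {e e' ρ κ} → ⟨ app e e' , ρ , κ ⟩ ⟶[ 1 ] ⟨ e , ρ , argK e' ρ κ ⟩
  s-arg  : ∀ {v e' ρ ρ' κ} → IsValue v
         → ⟨ v , ρ , argK e' ρ' κ ⟩ ⟶[ 1 ] ⟨ e' , ρ' , funK v ρ κ ⟩
  s-fun  : ∀ {v' ρ' x e ρ κ} → IsValue v'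
         → ⟨ v' , ρ' , funK (lam x e) ρ κ ⟩ ⟶[ 1 ] ⟨ e , ρ [ x ↦ clo v' ρ' ] , κ ⟩
  s-if   : ∀ {e? et ef ρ κ} → ⟨ ifte e? et ef , ρ , κ ⟩ ⟶[ 1 ] ⟨ e? , ρ , testK et ef ρ κ ⟩
  s-tt   : ∀ {v ρ' et ef ρ κ} → IsValue v → v ≢ lit []
         → ⟨ v , ρ' , testK et ef ρ κ ⟩ ⟶[ 1 ] ⟨ et , ρ , κ ⟩
  s-ff   : ∀ {ρ' et ef ρ κ} → ⟨ lit [] , ρ' , testK et ef ρ κ ⟩ ⟶[ 1 ] ⟨ ef , ρ , κ ⟩
  s-prn  : ∀ {e ρ κ} → ⟨ prn e , ρ , κ ⟩ ⟶[ 1 ] ⟨ prnUnfold e , ρ , κ ⟩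

data _⟶*[_]_ : State → ℕ → State → Set where
  done : ∀ {s} → s ⟶*[ 0 ] s
  step : ∀ {s s' s'' c c'} → s ⟶[ c ] s' → s' ⟶*[ c' ] s'' → s ⟶*[ c + c' ] s''

OEnv : Set
OEnv = List (Var × Str)

star : OEnv → CEnv
star []             = []
star ((x , s) ∷ ρ) = (x , clo (lit s) []) ∷ star ρ

CEKCost : Tm → OEnv → ℕ → Set
CEKCost e ρ c = Σ Tm λ v → Σ CEnv λ ρ' →
  IsValue v × (⟨ e , star ρ , halt ⟩ ⟶*[ c ] ⟨ v , ρ' , halt ⟩)

applyAll : ∀ {ℓ} → Tm → Vec Str ℓ → Tm
applyAll e []       = e
applyAll e (w ∷ ws) = applyAll (app e (lit w)) ws

bindAll : ∀ {k} → Vec Var k → Base → Ctx → Ctx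
bindAll []       b Γ z = Γ z
bindAll (x ∷ xs) b Γ z = if z ≡ᵇ x then just b else bindAll xs b Γ z

ctxOf : ∀ {m n} → Vec Var m → Vec Var n → Ctx
ctxOf xs ys = bindAll xs Nnorm (bindAll ys Nsafe (λ _ → nothing))

zipEnv : ∀ {k} → Vec Var k → Vec Str k → OEnv
zipEnv []       []       = []
zipEnv (x ∷ xs) (s ∷ ss) = (x , s) ∷ zipEnv xs ss

_++E_ : OEnv → OEnv → OEnv
[] ++E ρ = ρ
(p ∷ ρ) ++E ρ' = p ∷ (ρ ++E ρ')

data Poly (k : ℕ) : Set where
  pconst : ℕ → Poly k
  pvar   : Fin k → Poly k
  _p+_   : Poly k → Poly k → Poly k
  _p*_   : Poly k → Poly k → Poly k

⟦_⟧ : ∀ {k} → Poly k → Vec ℕ k → ℕ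
⟦ pconst c ⟧ a = c
⟦ pvar i ⟧   a = lookup a i
⟦ p p+ q ⟧   a = ⟦ p ⟧ a + ⟦ q ⟧ a
⟦ p p* q ⟧   a = ⟦ p ⟧ a * ⟦ q ⟧ a

module Submission where

-- A logical relation indexed by a univariate polynomial p and by bounds N, S
-- on the lengths of the normal and the safe inputs.  A term of base type evaluates within
-- p (N + S) steps, and a safe result has length at most S + p N, i.e. it exceeds the safe
-- inputs only additively.  Feeding a result back as a safe input raises S by some q N, which
-- is absorbed into the polynomial p ∘ (X ⊕ q) ⊕ q.  A recursion on a normal string s unfolds
-- |s| + 1 times; each unfolding raises the safe bound by p N and costs a fixed polynomial in
-- N + S, so by induction on s the whole recursion costs (|s| + 1) times that polynomial.
-- Finally N = S = the total length of all inputs turns the bound into a polynomial in them.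

open import Defs
open import Data.Bool using (true; false)
open import Data.Fin using (Fin)
open import Data.List using (length; []; _∷_)
open import Data.List.Relation.Unary.Unique.Propositional using (Unique)
open import Data.Maybe using (just; nothing)
open import Data.Nat using (ℕ; zero; suc; _+_; _*_; _⊔_; _≤_; _≡ᵇ_; _≤ᵇ_; z≤n; s≤s)
open import Data.Nat.Properties
open import Data.Nat.Tactic.RingSolver using (solve-∀)
open import Data.Product using (Σ; _×_; _,_; proj₁; proj₂)
open import Data.Vec using (Vec; []; _∷_; toList; map; _++_; lookup; sum; allFin)
open import Data.Vec.Properties using (sum-++; map-lookup-allFin)
open import Relation.Binary.PropositionalEquality
open import Function using (_∘′_)

infixl 6 _⊕_
infixl 7 _⊗_
infixr 9 _∘_
infix 4 _≼_

data UPoly : Set where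
  con : ℕ → UPoly
  X   : UPoly
  _⊕_ _⊗_ _∘_ : UPoly → UPoly → UPoly

eval : UPoly → ℕ → ℕ
eval (con k) x = k
eval X       x = x
eval (p ⊕ q) x = eval p x + eval q x
eval (p ⊗ q) x = eval p x * eval q x
eval (p ∘ q) x = eval p (eval q x)

eval-mono : ∀ p {x y} → x ≤ y → eval p x ≤ eval p y
eval-mono (con k) _   = ≤-refl
eval-mono X       x≤y = x≤y
eval-mono (p ⊕ q) x≤y = +-mono-≤ (eval-mono p x≤y) (eval-mono q x≤y)
eval-mono (p ⊗ q) x≤y = *-mono-≤ (eval-mono p x≤y) (eval-mono q x≤y)
eval-mono (p ∘ q) x≤y = eval-mono p (eval-mono q x≤y)

record _≼_ (p q : UPoly) : Set where
  constructor pointwise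
  field ≼-eval : ∀ x → eval p x ≤ eval q x
open _≼_

≼-trans : ∀ {p q r} → p ≼ q → q ≼ r → p ≼ r
≼-trans p≼q q≼r = pointwise λ x → ≤-trans (≼-eval p≼q x) (≼-eval q≼r x)

≼-⊕ˡ : ∀ {p q} → p ≼ p ⊕ q
≼-⊕ˡ {p} {q} = pointwise λ x → m≤m+n (eval p x) (eval q x)

≼-⊕ʳ : ∀ {p q} → q ≼ p ⊕ q
≼-⊕ʳ {p} {q} = pointwise λ x → m≤n+m (eval q x) (eval p x)

absorb : UPoly → UPoly → UPoly
absorb p q = p ∘ (X ⊕ q) ⊕ q

≼-absorb : ∀ {p q} → p ≼ absorb p q
≼-absorb {p} {q} = pointwise λ x → ≤-trans (eval-mono p (m≤m+n x (eval q x))) (m≤m+n _ (eval q x))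

Run : Tm → CEnv → ℕ → Tm → CEnv → Set
Run e ρ c v ρ' = ∀ κ → ⟨ e , ρ , κ ⟩ ⟶*[ c ] ⟨ v , ρ' , κ ⟩

infixr 5 _▷_

_▷_ : ∀ {s s' s'' k k'} → s ⟶*[ k ] s' → s' ⟶*[ k' ] s'' → s ⟶*[ k + k' ] s''
done ▷ r' = r'
_▷_ {s} {s'' = s''} {k' = k'} (step {c = k₀} {c' = k₁} t r) r' =
  subst (λ k → s ⟶*[ k ] s'') (sym (+-assoc k₀ k₁ k')) (step t (r ▷ r'))

recost : ∀ {e ρ k k' v ρ'} → k ≡ k' → Run e ρ k v ρ' → Run e ρ k' v ρ'
recost refl r = r

run-value : ∀ {v ρ} → Run v ρ 0 v ρ
run-value κ = done

run-var : ∀ {x ρ v ρ'} → lookupEnv ρ x ≡ just (clo v ρ') → Run (var x) ρ (lookupCost v) v ρ'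
run-var {v = v} found = recost (+-identityʳ (lookupCost v)) (λ κ → step (s-var found) done)

run-prn : ∀ {e ρ} → Run (prn e) ρ 1 (prnUnfold e) ρ
run-prn κ = step s-prn done

run-bop : ∀ {B e ρ k s ρ'} → Run e ρ k (lit s) ρ' → Run (bop B e) ρ (2 + k) (lit (applyB B s)) []
run-bop {B} {k = k} r = recost (shape k) (λ κ → step s-op (r (opK B κ) ▷ step s-op' done))
  where
  shape : ∀ k → 1 + (k + (1 + 0)) ≡ 2 + k
  shape = solve-∀

run-app : ∀ {e₀ e₁ ρ k₀ k₁ k₂ x b ρ₀ s ρ₁ v ρ'} →
  Run e₀ ρ k₀ (lam x b) ρ₀ → Run e₁ ρ k₁ (lit s) ρ₁ → Run b (ρ₀ [ x ↦ clo (lit s) ρ₁ ]) k₂ v ρ' →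
  Run (app e₀ e₁) ρ (3 + k₀ + k₁ + k₂) v ρ'
run-app {e₁ = e₁} {ρ} {k₀} {k₁} {k₂} {x} {b} {ρ₀} r₀ r₁ r₂ = recost (shape k₀ k₁ k₂) λ κ →
  step s-app (r₀ (argK e₁ ρ κ) ▷ step (s-arg vlam) (r₁ (funK (lam x b) ρ₀ κ) ▷ step (s-fun vlit) (r₂ κ)))
  where
  shape : ∀ k₀ k₁ k₂ → 1 + (k₀ + (1 + (k₁ + (1 + k₂)))) ≡ 3 + k₀ + k₁ + k₂
  shape = solve-∀

run-down : ∀ {e₀ e₁ ρ k₀ k₁ s₀ s₁ ρ₀ ρ₁} → Run e₀ ρ k₀ (lit s₀) ρ₀ → Run e₁ ρ k₁ (lit s₁) ρ₁ →
  Run (down e₀ e₁) ρ (3 + k₀ + k₁ + ∣ s₀ ∣ + ∣ s₁ ∣) (lit (downF s₀ s₁)) []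
run-down {e₁ = e₁} {ρ} {k₀} {k₁} {s₀} {s₁} r₀ r₁ = recost (shape k₀ k₁ ∣ s₀ ∣ ∣ s₁ ∣) λ κ →
  step s-dn (r₀ (dnK e₁ ρ κ) ▷ step (s-dn1 vlit) (r₁ (dn'K (lit s₀) κ) ▷ step s-dn2 done))
  where
  shape : ∀ k₀ k₁ l₀ l₁ → 1 + (k₀ + (1 + (k₁ + ((1 + l₀ + l₁) + 0)))) ≡ 3 + k₀ + k₁ + l₀ + l₁
  shape = solve-∀

run-if-true : ∀ {e₀ e₁ e₂ ρ k₀ k₁ a s ρ₀ v ρ'} → Run e₀ ρ k₀ (lit (a ∷ s)) ρ₀ → Run e₁ ρ k₁ v ρ' →
  Run (ifte e₀ e₁ e₂) ρ (2 + k₀ + k₁) v ρ'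
run-if-true {e₁ = e₁} {e₂} {ρ} {k₀} {k₁} r₀ r₁ = recost (shape k₀ k₁) λ κ →
  step s-if (r₀ (testK e₁ e₂ ρ κ) ▷ step (s-tt vlit (λ ())) (r₁ κ))
  where
  shape : ∀ k₀ k₁ → 1 + (k₀ + (1 + k₁)) ≡ 2 + k₀ + k₁
  shape = solve-∀

run-if-false : ∀ {e₀ e₁ e₂ ρ k₀ k₂ ρ₀ v ρ'} → Run e₀ ρ k₀ (lit []) ρ₀ → Run e₂ ρ k₂ v ρ' →
  Run (ifte e₀ e₁ e₂) ρ (2 + k₀ + k₂) v ρ'
run-if-false {e₁ = e₁} {e₂} {ρ} {k₀} {k₂} r₀ r₂ = recost (shape k₀ k₂) λ κ →
  step s-if (r₀ (testK e₁ e₂ ρ κ) ▷ step s-ff (r₂ κ))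
  where
  shape : ∀ k₀ k₂ → 1 + (k₀ + (1 + k₂)) ≡ 2 + k₀ + k₂
  shape = solve-∀

Fits : Base → Str → ℕ → ℕ → Set
Fits Nnorm s N S = ∣ s ∣ ≤ N
Fits Nsafe s N S = ∣ s ∣ ≤ S

fits-mono : ∀ a {s N S N' S'} → N ≤ N' → S ≤ S' → Fits a s N S → Fits a s N' S'
fits-mono Nnorm N≤N' _ fits = ≤-trans fits N≤N'
fits-mono Nsafe _ S≤S' fits = ≤-trans fits S≤S'

fits-≤ : ∀ a {s T} → ∣ s ∣ ≤ T → Fits a s T T
fits-≤ Nnorm fits = fits
fits-≤ Nsafe fits = fits

fits-≤B : ∀ {a b s N S} → a ≤B b → Fits a s N S → Fits b s N (S + N)
fits-≤B {Nnorm} ≤B-refl fits         = fits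
fits-≤B {Nsafe} {S = S} ≤B-refl fits = ≤-trans fits (m≤m+n S _)
fits-≤B {S = S} norm≤safe fits       = ≤-trans fits (m≤n+m _ S)

Value : Ty → Set
Value (base _) = Str
Value (_ ⇒ _)  = Var × Tm

⌜_⌝ : ∀ {τ} → Value τ → Tm
⌜_⌝ {base _} s       = lit s
⌜_⌝ {_ ⇒ _} (x , b) = lam x b

record Terminates (τ : Ty) (e : Tm) (ρ : CEnv) (budget : ℕ) (Good : Value τ → CEnv → Set) : Set where
  constructor terminates
  field
    cost   : ℕ
    value  : Value τ
    env    : CEnv
    run    : Run e ρ cost ⌜ value ⌝ env
    within : cost ≤ budget
    good   : Good value env

Terminates-mono : ∀ {τ e ρ budget budget'} {G G' : Value τ → CEnv → Set} → budget ≤ budget' →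
  (∀ {w ρ'} → G w ρ' → G' w ρ') → Terminates τ e ρ budget G → Terminates τ e ρ budget' G'
Terminates-mono b≤b' G⇒G' (terminates c w ρ' r c≤b g) = terminates c w ρ' r (≤-trans c≤b b≤b') (G⇒G' g)

Val  : (τ : Ty) → UPoly → ℕ → ℕ → Value τ → CEnv → Set
Comp : Ty → UPoly → ℕ → ℕ → Tm → CEnv → Set
Val (base a) p N S s       _ = Fits a s N (S + eval p N)
Val (a ⇒ τ)  p N S (x , b) ρ = ∀ {N' S'} → N ≤ N' → S ≤ S' → ∀ s ρs → Fits a s N' S' →
  Comp τ p N' S' b (ρ [ x ↦ clo (lit s) ρs ])
Comp τ p N S e ρ = Terminates τ e ρ (eval p (N + S)) (Val τ p N S)

val-≼ : ∀ τ {p q N S w ρ} → p ≼ q → Val τ p N S w ρ → Val τ q N S w ρ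
val-≼ (base a) {N = N} {S} p≼q v = fits-mono a ≤-refl (+-monoʳ-≤ S (≼-eval p≼q N)) v
val-≼ (a ⇒ τ) p≼q f N≤N' S≤S' s ρs fits =
  Terminates-mono (≼-eval p≼q _) (val-≼ τ p≼q) (f N≤N' S≤S' s ρs fits)

absorb-bound : ∀ p q N S → eval p (N + (S + eval q N)) ≤ eval (absorb p q) (N + S)
absorb-bound p q N S = begin
  eval p (N + (S + eval q N))   ≡⟨ cong (eval p) (+-assoc N S (eval q N)) ⟨
  eval p (N + S + eval q N)     ≤⟨ eval-mono p (+-monoʳ-≤ (N + S) (eval-mono q (m≤m+n N S))) ⟩
  eval p (N + S + eval q (N + S)) ≤⟨ m≤m+n _ (eval q (N + S)) ⟩
  eval (absorb p q) (N + S)     ∎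
  where open ≤-Reasoning

val-absorb  : ∀ τ {p q N S w ρ} → Val τ p N (S + eval q N) w ρ → Val τ (absorb p q) N S w ρ
comp-absorb : ∀ τ {p q N S e ρ} → Comp τ p N (S + eval q N) e ρ → Comp τ (absorb p q) N S e ρ

val-absorb (base a) {p} {q} {N} {S} v = fits-mono a ≤-refl S+qN+pN≤ v
  where
  open ≤-Reasoning
  S+qN+pN≤ : S + eval q N + eval p N ≤ S + eval (absorb p q) N
  S+qN+pN≤ = begin
    S + eval q N + eval p N            ≡⟨ +-assoc S (eval q N) (eval p N) ⟩
    S + (eval q N + eval p N)          ≡⟨ cong (S +_) (+-comm (eval q N) (eval p N)) ⟩
    S + (eval p N + eval q N)          ≤⟨ +-monoʳ-≤ S (+-monoˡ-≤ (eval q N) (eval-mono p (m≤m+n N (eval q N)))) ⟩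
    S + eval (absorb p q) N            ∎
val-absorb (a ⇒ τ) {q = q} f {N'} {S'} N≤N' S≤S' s ρs fits =
  comp-absorb τ (f N≤N' (+-mono-≤ S≤S' (eval-mono q N≤N')) s ρs (fits-mono a ≤-refl (m≤m+n S' _) fits))

comp-absorb τ {p} {q} {N} {S} = Terminates-mono (absorb-bound p q N S) (val-absorb τ)

subsume : ∀ {σ τ} → σ <: τ → UPoly → UPoly
subsume (<:-base _)  p = p ⊕ X
subsume (<:-arr _ d) p = subsume d (absorb p X)

≼-subsume : ∀ {σ τ} (d : σ <: τ) {p} → p ≼ subsume d p
≼-subsume (<:-base _)  = ≼-⊕ˡ
≼-subsume (<:-arr _ d) = ≼-trans ≼-absorb (≼-subsume d)

coerce : ∀ {σ τ} → σ <: τ → Value σ → Value τ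
coerce (<:-base _)  s = s
coerce (<:-arr _ _) f = f

val-sub  : ∀ {σ τ} (d : σ <: τ) {p N S w ρ} → Val σ p N S w ρ → Val τ (subsume d p) N S (coerce d w) ρ
comp-sub : ∀ {σ τ} (d : σ <: τ) {p N S e ρ} → Comp σ p N S e ρ → Comp τ (subsume d p) N S e ρ

val-sub (<:-base {b = b} a≤b) {p} {N} {S} {s} v = subst (Fits b s N) (+-assoc S (eval p N) N) (fits-≤B a≤b v)
val-sub (<:-arr {τ = τ} a'≤a d) f N≤N' S≤S' s ρs fits =
  comp-sub d (comp-absorb τ (f N≤N' (≤-trans S≤S' (m≤m+n _ _)) s ρs (fits-≤B a'≤a fits)))

comp-sub d@(<:-base _)  {p} {N} {S} (terminates c w ρ' r c≤b v) =
  terminates c w ρ' r (≤-trans c≤b (≼-eval (≼-subsume d {p}) _)) (val-sub d {p} {N} {S} {w} {ρ'} v)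
comp-sub d@(<:-arr _ _) {p} {N} {S} (terminates c w ρ' r c≤b v) =
  terminates c w ρ' r (≤-trans c≤b (≼-eval (≼-subsume d {p}) _)) (val-sub d {p} {N} {S} {w} {ρ'} v)

infix 4 _⊆_

_⊆_ : Ctx → Ctx → Set
Γ₀ ⊆ Γ = ∀ {x σ} → Γ₀ x ≡ just σ → Γ x ≡ just σ

∪-⊆ˡ : ∀ Γ₀ Γ₁ → Γ₀ ⊆ Γ₀ ∪ Γ₁
∪-⊆ˡ Γ₀ Γ₁ {x} Γ₀x with Γ₀ x
∪-⊆ˡ Γ₀ Γ₁ refl | just _ = refl

∪-⊆ʳ : ∀ Γ₀ Γ₁ → Consistent Γ₀ Γ₁ → Γ₁ ⊆ Γ₀ ∪ Γ₁
∪-⊆ʳ Γ₀ Γ₁ consistent {x} {σ} Γ₁x with Γ₀ x in Γ₀x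
... | just τ  = cong just (consistent x τ σ Γ₀x Γ₁x)
... | nothing = Γ₁x

IsUnion⇒⊆ˡ : ∀ {Γ₀ Γ₁ Γ} → IsUnion Γ₀ Γ₁ Γ → Γ₀ ⊆ Γ
IsUnion⇒⊆ˡ {Γ₀} {Γ₁} (_ , Γ≗) {x} Γ₀x = trans (Γ≗ x) (∪-⊆ˡ Γ₀ Γ₁ Γ₀x)

IsUnion⇒⊆ʳ : ∀ {Γ₀ Γ₁ Γ} → IsUnion Γ₀ Γ₁ Γ → Γ₁ ⊆ Γ
IsUnion⇒⊆ʳ {Γ₀} {Γ₁} (consistent , Γ≗) {x} Γ₁x = trans (Γ≗ x) (∪-⊆ʳ Γ₀ Γ₁ consistent Γ₁x)

IsUnion3⇒⊆₀ : ∀ {Γ₀ Γ₁ Γ₂ Γ} → IsUnion3 Γ₀ Γ₁ Γ₂ Γ → Γ₀ ⊆ Γ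
IsUnion3⇒⊆₀ {Γ₀} {Γ₁} {Γ₂} (_ , consistent' , Γ≗) Γ₀x =
  IsUnion⇒⊆ˡ {Γ₀ ∪ Γ₁} {Γ₂} (consistent' , Γ≗) (∪-⊆ˡ Γ₀ Γ₁ Γ₀x)

IsUnion3⇒⊆₁ : ∀ {Γ₀ Γ₁ Γ₂ Γ} → IsUnion3 Γ₀ Γ₁ Γ₂ Γ → Γ₁ ⊆ Γ
IsUnion3⇒⊆₁ {Γ₀} {Γ₁} {Γ₂} (consistent , consistent' , Γ≗) Γ₁x =
  IsUnion⇒⊆ˡ {Γ₀ ∪ Γ₁} {Γ₂} (consistent' , Γ≗) (∪-⊆ʳ Γ₀ Γ₁ consistent Γ₁x)

IsUnion3⇒⊆₂ : ∀ {Γ₀ Γ₁ Γ₂ Γ} → IsUnion3 Γ₀ Γ₁ Γ₂ Γ → Γ₂ ⊆ Γ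
IsUnion3⇒⊆₂ {Γ₀} {Γ₁} {Γ₂} (_ , consistent' , Γ≗) =
  IsUnion⇒⊆ʳ {Γ₀ ∪ Γ₁} {Γ₂} (consistent' , Γ≗)

≡ᵇ-refl : ∀ n → (n ≡ᵇ n) ≡ true
≡ᵇ-refl zero    = refl
≡ᵇ-refl (suc n) = ≡ᵇ-refl n

≤⇒≢ᵇsuc : ∀ {z M} → z ≤ M → (z ≡ᵇ suc M) ≡ false
≤⇒≢ᵇsuc z≤n       = refl
≤⇒≢ᵇsuc (s≤s z≤M) = ≤⇒≢ᵇsuc z≤M

lookup-[↦] : ∀ ρ x c → lookupEnv (ρ [ x ↦ c ]) x ≡ just c
lookup-[↦] ρ x c rewrite ≡ᵇ-refl x = refl

BindsFitting : CEnv → Var → Base → ℕ → ℕ → Set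
BindsFitting ρ x σ N S = Σ Str λ s → Σ CEnv λ ρs → lookupEnv ρ x ≡ just (clo (lit s) ρs) × Fits σ s N S

-- Only the variables up to M are constrained, so that a binder chosen above maxVar e
-- can be added without looking at Γ (which may mention it).
record EnvFits (M : ℕ) (Γ : Ctx) (ρ : CEnv) (N S : ℕ) : Set where
  constructor envFits
  field lookup-fits : ∀ {x σ} → x ≤ M → Γ x ≡ just σ → BindsFitting ρ x σ N S
open EnvFits

envFits-mono : ∀ {M Γ ρ N S N' S'} → N ≤ N' → S ≤ S' → EnvFits M Γ ρ N S → EnvFits M Γ ρ N' S'
envFits-mono N≤N' S≤S' fits = envFits λ {_} {σ} x≤M Γx →
  let (s , ρs , found , s-fits) = lookup-fits fits x≤M Γx in s , ρs , found , fits-mono σ N≤N' S≤S' s-fits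

envFits-⊆ : ∀ {M₀ M Γ₀ Γ ρ N S} → M₀ ≤ M → Γ₀ ⊆ Γ → EnvFits M Γ ρ N S → EnvFits M₀ Γ₀ ρ N S
envFits-⊆ M₀≤M Γ₀⊆Γ fits = envFits λ x≤M₀ Γ₀x → lookup-fits fits (≤-trans x≤M₀ M₀≤M) (Γ₀⊆Γ Γ₀x)

envFits-bind : ∀ {Γ ρ N S} x σ M {s ρs} → EnvFits (x ⊔ M) Γ ρ N S → Fits σ s N S →
  EnvFits M (Γ ,, x ∶ σ) (ρ [ x ↦ clo (lit s) ρs ]) N S
envFits-bind {Γ} {ρ} {N} {S} x σ M {s} {ρs} fits s-fits = envFits fits'
  where
  fits' : ∀ {z σ'} → z ≤ M → (Γ ,, x ∶ σ) z ≡ just σ' → BindsFitting (ρ [ x ↦ clo (lit s) ρs ]) z σ' N S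
  fits' {z} z≤M Γ'z with z ≡ᵇ x | Γ'z
  ... | true  | refl = s , ρs , refl , s-fits
  ... | false | Γz   = lookup-fits fits (≤-trans z≤M (m≤n⊔m x M)) Γz

envFits-fresh : ∀ {M Γ ρ N S} c → EnvFits M Γ ρ N S → EnvFits M Γ (ρ [ suc M ↦ c ]) N S
envFits-fresh {M} {Γ} {ρ} {N} {S} c fits = envFits fits'
  where
  fits' : ∀ {z σ} → z ≤ M → Γ z ≡ just σ → BindsFitting (ρ [ suc M ↦ c ]) z σ N S
  fits' z≤M Γz rewrite ≤⇒≢ᵇsuc z≤M = lookup-fits fits z≤M Γz

infix 4 _⊨_∶_

_⊨_∶_ : Ctx → Tm → Ty → Set
Γ ⊨ e ∶ τ = Σ UPoly λ p → ∀ {ρ N S} → EnvFits (maxVar e) Γ ρ N S → Comp τ p N S e ρ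

lookupCost-lit : ∀ {s B} → ∣ s ∣ ≤ B → lookupCost (lit s) ≤ 1 + B
lookupCost-lit {B = B} s≤B = ⊔-lub (s≤s z≤n) (≤-trans s≤B (n≤1+n B))

fits⇒≤+ : ∀ a {s N S} → Fits a s N S → ∣ s ∣ ≤ N + S
fits⇒≤+ Nnorm {N = N} {S} fits = ≤-trans fits (m≤m+n N S)
fits⇒≤+ Nsafe {N = N} {S} fits = ≤-trans fits (m≤n+m S N)

safe⇒≤+ : ∀ p {s N S} → ∣ s ∣ ≤ S + eval p N → ∣ s ∣ ≤ N + S + eval p (N + S)
safe⇒≤+ p {N = N} {S} s≤ = ≤-trans s≤ (+-mono-≤ (m≤n+m S N) (eval-mono p (m≤m+n N S)))

∣applyB∣≤ : ∀ B s → ∣ applyB B s ∣ ≤ suc ∣ s ∣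
∣applyB∣≤ c₀ s = ≤-refl
∣applyB∣≤ c₁ s = ≤-refl
∣applyB∣≤ dd [] = z≤n
∣applyB∣≤ dd (_ ∷ s) = ≤-trans (n≤1+n ∣ s ∣) (n≤1+n (suc ∣ s ∣))
∣applyB∣≤ t₀ s with hasHead false s
... | true  = s≤s z≤n
... | false = z≤n
∣applyB∣≤ t₁ s with hasHead true s
... | true  = s≤s z≤n
... | false = z≤n

∣dd∣≤ : ∀ s → ∣ applyB dd s ∣ ≤ ∣ s ∣
∣dd∣≤ []      = z≤n
∣dd∣≤ (_ ∷ s) = n≤1+n ∣ s ∣

∣downF∣≤ : ∀ s₀ s₁ → ∣ downF s₀ s₁ ∣ ≤ ∣ s₀ ∣
∣downF∣≤ s₀ s₁ with ∣ s₀ ∣ ≤ᵇ ∣ s₁ ∣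
... | true  = ≤-refl
... | false = z≤n

⊨-var : ∀ {Γ x σ} → Γ x ≡ just σ → Γ ⊨ var x ∶ base σ
⊨-var {σ = σ} Γx = con 1 ⊕ X , λ {_} {N} {S} fits →
  let (s , ρs , found , s-fits) = lookup-fits fits ≤-refl Γx
  in terminates _ s ρs (run-var found) (lookupCost-lit {s} (fits⇒≤+ σ s-fits))
       (fits-mono σ ≤-refl (m≤m+n S _) s-fits)

⊨-lam : ∀ {Γ x σ e τ} → (Γ ,, x ∶ σ) ⊨ e ∶ τ → Γ ⊨ lam x e ∶ σ ⇒ τ
⊨-lam {x = x} {σ} {e} (p , ⊨e) = p , λ fits →
  terminates 0 (x , e) _ run-value z≤n λ N≤N' S≤S' s ρs s-fits →
    ⊨e (envFits-bind x σ (maxVar e) (envFits-mono N≤N' S≤S' fits) s-fits)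

⊨-app : ∀ {Γ Γ₀ Γ₁ e₀ e₁ σ τ} → Γ₀ ⊨ e₀ ∶ σ ⇒ τ → Γ₁ ⊨ e₁ ∶ base σ → IsUnion Γ₀ Γ₁ Γ →
  Γ ⊨ app e₀ e₁ ∶ τ
⊨-app {e₀ = e₀} {e₁} {τ = τ} (p₀ , ⊨e₀) (p₁ , ⊨e₁) u =
  con 3 ⊕ p₀ ⊕ p₁ ⊕ absorb p₀ p₁ , λ {_} {N} {S} fits →
  let terminates _ _ _ r₀ k₀≤ f   = ⊨e₀ (envFits-⊆ (m≤m⊔n (maxVar e₀) (maxVar e₁)) (IsUnion⇒⊆ˡ u) fits)
      terminates _ s ρ₁ r₁ k₁≤ s-fits = ⊨e₁ (envFits-⊆ (m≤n⊔m (maxVar e₀) (maxVar e₁)) (IsUnion⇒⊆ʳ u) fits)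
      terminates _ w ρ' r₂ k₂≤ v = comp-absorb τ (f ≤-refl (m≤m+n S _) s ρ₁ s-fits)
  in terminates _ w ρ' (run-app r₀ r₁ r₂) (+-mono-≤ (+-mono-≤ (+-monoʳ-≤ 3 k₀≤) k₁≤) k₂≤) (val-≼ τ ≼-⊕ʳ v)

⊨-lit : ∀ {Γ k} → Γ ⊨ lit k ∶ base Nsafe
⊨-lit {k = k} = con ∣ k ∣ , λ {_} {_} {S} _ → terminates 0 k _ run-value z≤n (m≤n+m ∣ k ∣ S)

⊨-ε : ∀ {Γ} → Γ ⊨ lit [] ∶ base Nnorm
⊨-ε = con 0 , λ _ → terminates 0 [] _ run-value z≤n z≤n

⊨-op : ∀ {Γ B e} → Γ ⊨ e ∶ base Nsafe → Γ ⊨ bop B e ∶ base Nsafe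
⊨-op {B = B} (p , ⊨e) = con 2 ⊕ p , λ {_} {N} {S} fits →
  let terminates _ s _ r k≤ s≤ = ⊨e fits
  in terminates _ (applyB B s) [] (run-bop r) (+-monoʳ-≤ 2 k≤) (begin
    ∣ applyB B s ∣     ≤⟨ ∣applyB∣≤ B s ⟩
    suc ∣ s ∣          ≤⟨ s≤s s≤ ⟩
    suc (S + eval p N) ≡⟨ +-suc S (eval p N) ⟨
    S + suc (eval p N) ≤⟨ +-monoʳ-≤ S (n≤1+n _) ⟩
    S + (2 + eval p N) ∎)
  where open ≤-Reasoning

⊨-d : ∀ {Γ e} → Γ ⊨ e ∶ base Nnorm → Γ ⊨ bop dd e ∶ base Nnorm
⊨-d (p , ⊨e) = con 2 ⊕ p , λ fits →
  let terminates _ s _ r k≤ s≤ = ⊨e fits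
  in terminates _ (applyB dd s) [] (run-bop r) (+-monoʳ-≤ 2 k≤) (≤-trans (∣dd∣≤ s) s≤)

⊨-down : ∀ {Γ Γ₀ Γ₁ e₀ e₁} → Γ₀ ⊨ e₀ ∶ base Nsafe → Γ₁ ⊨ e₁ ∶ base Nsafe → IsUnion Γ₀ Γ₁ Γ →
  Γ ⊨ down e₀ e₁ ∶ base Nsafe
⊨-down {e₀ = e₀} {e₁} (p₀ , ⊨e₀) (p₁ , ⊨e₁) u = p , λ {_} {N} {S} fits →
  let terminates _ s₀ _ r₀ k₀≤ s₀≤ = ⊨e₀ (envFits-⊆ (m≤m⊔n (maxVar e₀) (maxVar e₁)) (IsUnion⇒⊆ˡ u) fits)
      terminates _ s₁ _ r₁ k₁≤ s₁≤ = ⊨e₁ (envFits-⊆ (m≤n⊔m (maxVar e₀) (maxVar e₁)) (IsUnion⇒⊆ʳ u) fits)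
  in terminates _ (downF s₀ s₁) [] (run-down r₀ r₁)
       (+-mono-≤ (+-mono-≤ (+-mono-≤ (+-monoʳ-≤ 3 k₀≤) k₁≤) (safe⇒≤+ p₀ {s₀} s₀≤)) (safe⇒≤+ p₁ {s₁} s₁≤))
       (≤-trans (∣downF∣≤ s₀ s₁) (≤-trans s₀≤ (+-monoʳ-≤ S (≼-eval p₀≼p N))))
  where
  p = con 3 ⊕ p₀ ⊕ p₁ ⊕ (X ⊕ p₀) ⊕ (X ⊕ p₁)
  p₀≼p : p₀ ≼ p
  p₀≼p = ≼-trans ≼-⊕ʳ (≼-trans ≼-⊕ˡ (≼-trans ≼-⊕ˡ ≼-⊕ˡ))

⊨-sub : ∀ {Γ e σ τ} → Γ ⊨ e ∶ σ → σ <: τ → Γ ⊨ e ∶ τ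
⊨-sub (p , ⊨e) d = subsume d p , λ fits → comp-sub d (⊨e fits)

⊨-if : ∀ {Γ Γ₀ Γ₁ Γ₂ e₀ e₁ e₂} → Γ₀ ⊨ e₀ ∶ base Nsafe → Γ₁ ⊨ e₁ ∶ base Nsafe → Γ₂ ⊨ e₂ ∶ base Nsafe →
  IsUnion3 Γ₀ Γ₁ Γ₂ Γ → Γ ⊨ ifte e₀ e₁ e₂ ∶ base Nsafe
⊨-if {e₀ = e₀} {e₁} {e₂} (p₀ , ⊨e₀) (p₁ , ⊨e₁) (p₂ , ⊨e₂) u = p , λ fits →
  let M₀ = maxVar e₀ ; M₁ = maxVar e₁ ; M₂ = maxVar e₂
      terminates _ s₀ _ r₀ k₀≤ _ = ⊨e₀ (envFits-⊆ (≤-trans (m≤m⊔n M₀ M₁) (m≤m⊔n _ M₂)) (IsUnion3⇒⊆₀ u) fits)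
  in select s₀ r₀ k₀≤
       (⊨e₁ (envFits-⊆ (≤-trans (m≤n⊔m M₀ M₁) (m≤m⊔n _ M₂)) (IsUnion3⇒⊆₁ u) fits))
       (⊨e₂ (envFits-⊆ (m≤n⊔m (M₀ ⊔ M₁) M₂) (IsUnion3⇒⊆₂ u) fits))
  where
  p = con 2 ⊕ p₀ ⊕ (p₁ ⊕ p₂)
  p₁≼p : p₁ ≼ p
  p₁≼p = ≼-trans ≼-⊕ˡ ≼-⊕ʳ
  p₂≼p : p₂ ≼ p
  p₂≼p = ≼-trans ≼-⊕ʳ ≼-⊕ʳ
  select : ∀ {ρ N S k₀ ρ₀} s₀ → Run e₀ ρ k₀ (lit s₀) ρ₀ → k₀ ≤ eval p₀ (N + S) →
    Comp (base Nsafe) p₁ N S e₁ ρ → Comp (base Nsafe) p₂ N S e₂ ρ → Comp (base Nsafe) p N S (ifte e₀ e₁ e₂) ρ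
  select {N = N} {S} [] r₀ k₀≤ _ (terminates _ s ρ' r₂ k₂≤ s≤) =
    terminates _ s ρ' (run-if-false r₀ r₂) (+-mono-≤ (+-monoʳ-≤ 2 k₀≤) (≤-trans k₂≤ (m≤n+m _ _)))
      (≤-trans s≤ (+-monoʳ-≤ S (≼-eval p₂≼p N)))
  select {N = N} {S} (_ ∷ _) r₀ k₀≤ (terminates _ s ρ' r₁ k₁≤ s≤) _ =
    terminates _ s ρ' (run-if-true r₀ r₁) (+-mono-≤ (+-monoʳ-≤ 2 k₀≤) (≤-trans k₁≤ (m≤m+n _ _)))
      (≤-trans s≤ (+-monoʳ-≤ S (≼-eval p₁≼p N)))

module PrimitiveRecursion {Γ e} (⊨e : Γ ⊨ e ∶ Nnorm ⇒ Nsafe ⇒ base Nsafe) where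

  p : UPoly
  p = proj₁ ⊨e

  step-terminates : ∀ {ρ N S} → EnvFits (maxVar e) Γ ρ N S → Comp (Nnorm ⇒ Nsafe ⇒ base Nsafe) p N S e ρ
  step-terminates = proj₂ ⊨e

  y : Var
  y = suc (maxVar e)

  body : Tm
  body = ifte (var y) (app (app e (var y)) (app (prn e) (bop dd (var y)))) (app (app e (lit [])) (lit []))

  -- Bounds one unfolding.  Its last summand covers the final call of the step, whose safe
  -- argument (the result of the recursive call) has length at most S + |s| · p N.
  round : UPoly
  round = con 14 ⊕ con 3 ⊗ (con 1 ⊕ X) ⊕ p ⊕ p ⊕ p ∘ (X ⊕ (con 1 ⊕ X) ⊗ p)

  round-bound : ∀ {x L k₀ k₁ k₂} → L ≤ 1 + x → k₀ ≤ eval p x → k₁ ≤ eval p x →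
    k₂ ≤ eval p (x + (1 + x) * eval p x) → 14 + 3 * L + k₀ + k₁ + k₂ ≤ eval round x
  round-bound L≤ k₀≤ k₁≤ k₂≤ = +-mono-≤ (+-mono-≤ (+-mono-≤ (+-monoʳ-≤ 14 (*-monoʳ-≤ 3 L≤)) k₀≤) k₁≤) k₂≤

  body-terminates : ∀ s {ρ N S} ρs → EnvFits (maxVar e) Γ ρ N S → ∣ s ∣ ≤ N →
    Terminates (base Nsafe) body (ρ [ y ↦ clo (lit s) ρs ]) (suc ∣ s ∣ * eval round (N + S))
      (λ r _ → ∣ r ∣ ≤ S + suc ∣ s ∣ * eval p N)
  body-terminates [] {ρ} {N} {S} ρs fits _ =
    let ρ₁ = ρ [ y ↦ clo (lit []) ρs ]
        terminates k₀ _ _ r₀ k₀≤ f  = step-terminates (envFits-fresh (clo (lit []) ρs) fits)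
        terminates k₁ _ _ r₁ k₁≤ f₁ = f ≤-refl ≤-refl [] ρ₁ z≤n
        terminates k₂ o _ r₂ k₂≤ o≤ = f₁ ≤-refl ≤-refl [] ρ₁ z≤n
    in terminates _ o _
         (run-if-false (run-var (lookup-[↦] ρ y _)) (run-app (run-app r₀ run-value r₁) run-value r₂))
         (begin
           2 + 1 + (3 + (3 + k₀ + 0 + k₁) + 0 + k₂) ≡⟨ shape k₀ k₁ k₂ ⟩
           9 + k₀ + k₁ + k₂                         ≤⟨ +-monoˡ-≤ k₂ (+-monoˡ-≤ k₁ (+-monoˡ-≤ k₀ (m≤m+n 9 8))) ⟩
           14 + 3 * 1 + k₀ + k₁ + k₂                ≤⟨ round-bound (s≤s z≤n) k₀≤ k₁≤ (≤-trans k₂≤ (eval-mono p (m≤m+n _ _))) ⟩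
           eval round (N + S)                       ≡⟨ *-identityˡ _ ⟨
           1 * eval round (N + S)                   ∎)
         (≤-trans o≤ (≤-reflexive (cong (S +_) (sym (*-identityˡ _)))))
    where
    open ≤-Reasoning
    shape : ∀ k₀ k₁ k₂ → 2 + 1 + (3 + (3 + k₀ + 0 + k₁) + 0 + k₂) ≡ 9 + k₀ + k₁ + k₂
    shape = solve-∀
  body-terminates (b ∷ s') {ρ} {N} {S} ρs fits s≤N =
    let ρ₁    = ρ [ y ↦ clo (lit (b ∷ s')) ρs ]
        fits₁ = envFits-fresh (clo (lit (b ∷ s')) ρs) fits
        terminates k₀ _ _ r₀ k₀≤ f    = step-terminates fits₁
        terminates k₁ _ _ r₁ k₁≤ f₁   = f ≤-refl ≤-refl (b ∷ s') ρs s≤N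
        terminates kᵣ r _ rᵣ kᵣ≤ r≤   = body-terminates s' [] fits₁ s'≤N
        terminates k₂ o _ r₂ k₂≤ o≤   = f₁ ≤-refl (m≤m+n S _) r _ r≤
        here = run-var (lookup-[↦] ρ y _)
        L = lookupCost (lit (b ∷ s'))
    in terminates _ o _
         (run-if-true here (run-app (run-app r₀ here r₁) (run-app run-prn (run-bop here) rᵣ) r₂))
         (begin
           2 + L + (3 + (3 + k₀ + L + k₁) + (3 + 1 + (2 + L) + kᵣ) + k₂) ≡⟨ shape L k₀ k₁ kᵣ k₂ ⟩
           14 + 3 * L + k₀ + k₁ + k₂ + kᵣ
             ≤⟨ +-mono-≤ (round-bound (lookupCost-lit {b ∷ s'} (≤-trans s≤N (m≤m+n N S))) k₀≤ k₁≤
                                      (≤-trans k₂≤ (eval-mono p safe-arg≤))) kᵣ≤ ⟩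
           suc ∣ b ∷ s' ∣ * eval round (N + S) ∎)
         (begin
           ∣ o ∣                                    ≤⟨ o≤ ⟩
           S + suc ∣ s' ∣ * eval p N + eval p N      ≡⟨ +-assoc S _ (eval p N) ⟩
           S + (suc ∣ s' ∣ * eval p N + eval p N)    ≡⟨ cong (S +_) (+-comm _ (eval p N)) ⟩
           S + suc ∣ b ∷ s' ∣ * eval p N            ∎)
    where
    open ≤-Reasoning
    s'≤N : ∣ s' ∣ ≤ N
    s'≤N = ≤-trans (n≤1+n _) s≤N
    safe-arg≤ : N + (S + suc ∣ s' ∣ * eval p N) ≤ N + S + (1 + (N + S)) * eval p (N + S)
    safe-arg≤ = begin
      N + (S + suc ∣ s' ∣ * eval p N) ≡⟨ +-assoc N S _ ⟨
      N + S + suc ∣ s' ∣ * eval p N   ≤⟨ +-monoʳ-≤ (N + S) (*-mono-≤ (s≤s (≤-trans s'≤N (m≤m+n N S)))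
                                                                    (eval-mono p (m≤m+n N S))) ⟩
      N + S + (1 + (N + S)) * eval p (N + S) ∎
    shape : ∀ L k₀ k₁ kᵣ k₂ → 2 + L + (3 + (3 + k₀ + L + k₁) + (3 + 1 + (2 + L) + kᵣ) + k₂)
                            ≡ 14 + 3 * L + k₀ + k₁ + k₂ + kᵣ
    shape = solve-∀

  recursor : UPoly
  recursor = con 1 ⊕ (con 1 ⊕ X) ⊗ round ⊕ (con 1 ⊕ X) ⊗ p

  ⊨-prn : Γ ⊨ prn e ∶ Nnorm ⇒ base Nsafe
  ⊨-prn = recursor , λ fits → terminates 1 (y , body) _ run-prn (s≤s z≤n)
    λ {N'} {S'} N≤N' S≤S' s ρs s≤N' →
      Terminates-mono (cost≤ {s} {N'} {S'} s≤N') (λ r≤ → ≤-trans r≤ (+-monoʳ-≤ S' (result≤ {s} s≤N')))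
        (body-terminates s ρs (envFits-mono N≤N' S≤S' fits) s≤N')
    where
    cost≤ : ∀ {s N S} → ∣ s ∣ ≤ N → suc ∣ s ∣ * eval round (N + S) ≤ eval recursor (N + S)
    cost≤ {N = N} {S} s≤N = ≤-trans (*-monoˡ-≤ (eval round (N + S)) (s≤s (≤-trans s≤N (m≤m+n N S))))
                                    (≤-trans (m≤n+m _ 1) (m≤m+n _ (eval ((con 1 ⊕ X) ⊗ p) (N + S))))
    result≤ : ∀ {s N} → ∣ s ∣ ≤ N → suc ∣ s ∣ * eval p N ≤ eval recursor N
    result≤ {N = N} s≤N = ≤-trans (*-monoˡ-≤ (eval p N) (s≤s s≤N)) (m≤n+m _ (1 + eval ((con 1 ⊕ X) ⊗ round) N))

open PrimitiveRecursion using (⊨-prn)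

fundamental : ∀ {Γ e τ} → Γ ⊢ e ∶ τ → Γ ⊨ e ∶ τ
fundamental (⊢var Γx)           = ⊨-var Γx
fundamental (⊢lam _ ⊢e)         = ⊨-lam (fundamental ⊢e)
fundamental (⊢app ⊢e₀ ⊢e₁ u)    = ⊨-app (fundamental ⊢e₀) (fundamental ⊢e₁) u
fundamental ⊢lit                = ⊨-lit
fundamental ⊢ε                  = ⊨-ε
fundamental (⊢op ⊢e)            = ⊨-op (fundamental ⊢e)
fundamental (⊢d ⊢e)             = ⊨-d (fundamental ⊢e)
fundamental (⊢down ⊢e₀ ⊢e₁ u)   = ⊨-down (fundamental ⊢e₀) (fundamental ⊢e₁) u
fundamental (⊢if ⊢e₀ ⊢e₁ ⊢e₂ u) = ⊨-if (fundamental ⊢e₀) (fundamental ⊢e₁) (fundamental ⊢e₂) u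
fundamental (⊢sub ⊢e σ<:τ)      = ⊨-sub (fundamental ⊢e) σ<:τ
fundamental (⊢prn ⊢e)           = ⊨-prn (fundamental ⊢e)

applied : ℕ → UPoly → UPoly
applied zero    p = p
applied (suc ℓ) p = applied ℓ (con 3 ⊕ p ⊕ con 0 ⊕ p)

comp-app-lit : ∀ a τ {p N S e ρ w} → Fits a w N S → Comp (a ⇒ τ) p N S e ρ →
  Comp τ (con 3 ⊕ p ⊕ con 0 ⊕ p) N S (app e (lit w)) ρ
comp-app-lit a τ {ρ = ρ} {w} w-fits (terminates _ _ _ r k≤ f) =
  let terminates _ v ρ' r' k'≤ good = f ≤-refl ≤-refl w ρ w-fits
  in terminates _ v ρ' (run-app r run-value r') (+-mono-≤ (+-monoˡ-≤ 0 (+-monoʳ-≤ 3 k≤)) k'≤) (val-≼ τ ≼-⊕ʳ good)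

comp-applyAll : ∀ {ℓ} (bs : Vec Base ℓ) {b p T e ρ} (ws : Vec Str ℓ) → sum (map length ws) ≤ T →
  Comp (arrows bs b) p T T e ρ → Comp (base b) (applied ℓ p) T T (applyAll e ws) ρ
comp-applyAll []       []       _     C = C
comp-applyAll (a ∷ bs) (w ∷ ws) ws≤T C =
  comp-applyAll bs ws (≤-trans (m≤n+m _ ∣ w ∣) ws≤T)
    (comp-app-lit a (arrows bs _) (fits-≤ a (≤-trans (m≤m+n ∣ w ∣ _) ws≤T)) C)

Covers : ℕ → OEnv → Ctx → Set
Covers T ρ Γ = ∀ {z σ} → Γ z ≡ just σ → Σ Str λ s → lookupEnv (star ρ) z ≡ just (clo (lit s) []) × ∣ s ∣ ≤ T

covers-bindAll : ∀ {k T ρ Γ} (xs : Vec Var k) (us : Vec Str k) b → sum (map length us) ≤ T →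
  Covers T ρ Γ → Covers T (zipEnv xs us ++E ρ) (bindAll xs b Γ)
covers-bindAll []       []       b _     covers Γz = covers Γz
covers-bindAll (x ∷ xs) (u ∷ us) b us≤T covers {z} Γ'z with z ≡ᵇ x
... | true  = u , refl , ≤-trans (m≤m+n ∣ u ∣ _) us≤T
... | false = covers-bindAll xs us b (≤-trans (m≤n+m _ ∣ u ∣) us≤T) covers Γ'z

++E-identityʳ : ∀ ρ → ρ ++E [] ≡ ρ
++E-identityʳ []      = refl
++E-identityʳ (b ∷ ρ) = cong (b ∷_) (++E-identityʳ ρ)

covers⇒envFits : ∀ {M T ρ Γ} → Covers T ρ Γ → EnvFits M Γ (star ρ) T T
covers⇒envFits covers = envFits λ {_} {σ} _ Γx →
  let (s , found , s≤T) = covers Γx in s , [] , found , fits-≤ σ s≤T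

envFits-ctxOf : ∀ {m n M T} (xs : Vec Var m) (ys : Vec Var n) (us : Vec Str m) (vs : Vec Str n) →
  sum (map length us) ≤ T → sum (map length vs) ≤ T →
  EnvFits M (ctxOf xs ys) (star (zipEnv xs us ++E zipEnv ys vs)) T T
envFits-ctxOf xs ys us vs us≤T vs≤T = covers⇒envFits (covers-bindAll xs us Nnorm us≤T ys-covered)
  where
  ys-covered : Covers _ (zipEnv ys vs) (bindAll ys Nsafe (λ _ → nothing))
  ys-covered = subst (λ ρ → Covers _ ρ (bindAll ys Nsafe (λ _ → nothing))) (++E-identityʳ (zipEnv ys vs))
                     (covers-bindAll ys vs Nsafe vs≤T (λ ()))

embed : ∀ {k} → UPoly → Poly k → Poly k
embed (con c) q = pconst c
embed X       q = q
embed (p ⊕ r) q = embed p q p+ embed r q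
embed (p ⊗ r) q = embed p q p* embed r q
embed (p ∘ r) q = embed p (embed r q)

⟦embed⟧ : ∀ {k} p (q : Poly k) a → ⟦ embed p q ⟧ a ≡ eval p (⟦ q ⟧ a)
⟦embed⟧ (con c) q a = refl
⟦embed⟧ X       q a = refl
⟦embed⟧ (p ⊕ r) q a = cong₂ _+_ (⟦embed⟧ p q a) (⟦embed⟧ r q a)
⟦embed⟧ (p ⊗ r) q a = cong₂ _*_ (⟦embed⟧ p q a) (⟦embed⟧ r q a)
⟦embed⟧ (p ∘ r) q a = trans (⟦embed⟧ p (embed r q) a) (cong (eval p) (⟦embed⟧ r q a))

sumOver : ∀ {k j} → Vec (Fin k) j → Poly k
sumOver []       = pconst 0
sumOver (i ∷ is) = pvar i p+ sumOver is

⟦sumOver⟧ : ∀ {k j} (is : Vec (Fin k) j) a → ⟦ sumOver is ⟧ a ≡ sum (map (lookup a) is)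
⟦sumOver⟧ []       a = refl
⟦sumOver⟧ (i ∷ is) a = cong (lookup a i +_) (⟦sumOver⟧ is a)

total : ∀ {k} → Poly k
total {k} = sumOver (allFin k)

⟦embed-total⟧ : ∀ {k} p (a : Vec ℕ k) → ⟦ embed p total ⟧ a ≡ eval p (sum a)
⟦embed-total⟧ {k} p a = begin
  ⟦ embed p total ⟧ a               ≡⟨ ⟦embed⟧ p total a ⟩
  eval p (⟦ sumOver (allFin k) ⟧ a)  ≡⟨ cong (eval p) (⟦sumOver⟧ (allFin k) a) ⟩
  eval p (sum (map (lookup a) (allFin k))) ≡⟨ cong (eval p ∘′ sum) (map-lookup-allFin a) ⟩
  eval p (sum a)                    ∎
  where open ≡-Reasoning

sum-++₃ : ∀ {i j k} (a : Vec ℕ i) (b : Vec ℕ j) (c : Vec ℕ k) →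
  sum a ≤ sum ((a ++ b) ++ c) × sum b ≤ sum ((a ++ b) ++ c) × sum c ≤ sum ((a ++ b) ++ c)
sum-++₃ a b c rewrite sum-++ {ys = c} (a ++ b) | sum-++ {ys = b} a =
  ≤-trans (m≤m+n (sum a) (sum b)) (m≤m+n _ (sum c)) ,
  ≤-trans (m≤n+m (sum b) (sum a)) (m≤m+n _ (sum c)) ,
  m≤n+m (sum c) _

proposition3p2 : ∀ {m n ℓ} (xs : Vec Var m) (ys : Vec Var n)
    → Unique (toList xs Data.List.++ toList ys)
    → (e : Tm) (bs : Vec Base ℓ) (b : Base)
    → ctxOf xs ys ⊢ e ∶ arrows bs b
    → Σ (Poly (ℓ + m + n)) λ q →
        ∀ (ws : Vec Str ℓ) (us : Vec Str m) (vs : Vec Str n) →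
          Σ ℕ λ c → CEKCost (applyAll e ws) (zipEnv xs us ++E zipEnv ys vs) c
                  × c ≤ ⟦ q ⟧ ((map length ws ++ map length us) ++ map length vs)
proposition3p2 {ℓ = ℓ} xs ys _ e bs b ⊢e =
  let (p , ⊨e) = fundamental ⊢e
      q = applied ℓ p ∘ (X ⊕ X)
  in embed q total , λ ws us vs →
  let lengths = (map length ws ++ map length us) ++ map length vs
      (ws≤ , us≤ , vs≤) = sum-++₃ (map length ws) (map length us) (map length vs)
      terminates c s ρ' r c≤ _ = comp-applyAll bs ws ws≤ (⊨e (envFits-ctxOf xs ys us vs us≤ vs≤))
  in c , (lit s , ρ' , vlit , r halt) , ≤-trans c≤ (≤-reflexive (sym (⟦embed-total⟧ q lengths)))
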